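{- Let $p$ be a prime and $2\leq d\leq p$, and let $\mathcal{F}_p(x)=x(x-1)\cdots(x-(p-1))$. An integer polynomial $f(x)$ is a null polynomial modulo $p^d$ if and only if there exist integer polynomials $q_1(x),\dots,q_d(x)$, where $q_1,\dots,q_{d-1}$ have degree less than $p$ and $q_d$ is of arbitrary degree, such that $f(x)\equiv\sum_{n=1}^{d}p^{d-n}(\mathcal{F}_p(x))^nq_n(x)\pmod{p^d}$ (coefficientwise).
   Context: An integer polynomial $f$ is a null polynomial modulo $m$ if $f(x)\equiv 0\pmod m$ for every integer $x$. Congruence of polynomials modulo $m$ means congruence of all corresponding coefficients. -}

module Defs where

open import Data.Nat as ℕ using (ℕ; zero; suc)
open import Data.Integer as ℤ using (ℤ; +_; _+_; _*_; -_; _-_)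
open import Data.Integer.Divisibility using (_∣_)
open import Data.List using (List; []; _∷_; length)

-- Integer polynomials as coefficient lists, lowest degree first:
-- a₀ ∷ a₁ ∷ … represents a₀ + a₁ x + …  (trailing zeros allowed).
Poly : Set
Poly = List ℤ

coeff : Poly → ℕ → ℤ
coeff []       _       = + 0
coeff (a ∷ f)  zero    = a
coeff (a ∷ f)  (suc i) = coeff f i

eval : Poly → ℤ → ℤ
eval []      x = + 0
eval (a ∷ f) x = a + x * eval f x

_⊕_ : Poly → Poly → Poly
[]      ⊕ g       = g
(a ∷ f) ⊕ []      = a ∷ f
(a ∷ f) ⊕ (b ∷ g) = (a + b) ∷ (f ⊕ g)

_·_ : ℤ → Poly → Poly
c · []      = []
c · (a ∷ f) = (c * a) ∷ (c · f)

_⊗_ : Poly → Poly → Poly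
[]      ⊗ g = []
(a ∷ f) ⊗ g = (a · g) ⊕ (+ 0 ∷ (f ⊗ g))

_^ₚ_ : Poly → ℕ → Poly
f ^ₚ zero  = + 1 ∷ []
f ^ₚ suc n = f ⊗ (f ^ₚ n)

linear : ℤ → Poly
linear a = (- a) ∷ + 1 ∷ []

fallingPoly : ℕ → Poly
fallingPoly zero    = + 1 ∷ []
fallingPoly (suc k) = fallingPoly k ⊗ linear (+ k)

NullPoly : ℤ → Poly → Set
NullPoly m f = ∀ (x : ℤ) → m ∣ eval f x

_≡ₚ_[mod_] : Poly → Poly → ℤ → Set
f ≡ₚ g [mod m ] = ∀ (i : ℕ) → m ∣ (coeff f i - coeff g i)

DegLt : Poly → ℕ → Set
DegLt f k = length f ℕ.≤ k

-- Σ_{n=1}^{d} p^{d-n} F_p^n q_n, with q given as a function on indices 1..d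
-- sumFrom p d q k = Σ_{n=1}^{k} p^{d-n} F_p^n q_n
partialSum : ℕ → ℕ → (ℕ → Poly) → ℕ → Poly
partialSum p d q zero    = []
partialSum p d q (suc k) =
  partialSum p d q k ⊕ ((+ (p ℕ.^ (d ℕ.∸ suc k))) · ((fallingPoly p ^ₚ suc k) ⊗ q (suc k)))

-- Repeated division by F = F_p writes f = r₀ + F (r₁ + F (r₂ + ⋯ + F r_d)) with deg rₙ < p for
-- n < d. By induction on j ≤ d, p^(j−n) divides every coefficient of rₙ. For the step write
-- rₙ = p^(j−n) sₙ and fix a residue a < p. At x = a + p t one has F(x) = p ψ with
-- ψ ≡ c t (mod p), where c = ∏_{i<p, i≠a} (a − i) is prime to p, so p^(j+1) ∣ f(x) forces
-- Σ_{n≤j} sₙ(a) cⁿ tⁿ ≡ 0 (mod p) for every t. A polynomial with at most L ≤ p coefficients and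
-- L consecutive roots modulo p has all coefficients divisible by p; applied first to this
-- polynomial in t and then to each sₙ (which has p roots a), it gives p ∣ sₙ. At j = d,
-- rₙ = p^(d−n) qₙ is the required expansion, the term r₀ vanishing mod p^d. Conversely p
-- divides F(x) for every integer x, so p^d divides each term p^(d−n) F(x)ⁿ qₙ(x).

module Submission where

open import Defs
open import Data.Nat using (ℕ; _≤_; _<_; _^_)
open import Data.Nat.Primality using (Prime; euclidsLemma; prime⇒nonZero; prime⇒nonTrivial)
open import Data.Integer using (+_)
open import Data.Product using (Σ; _×_; _,_; proj₁; proj₂)
open import Function.Bundles using (_⇔_; mk⇔)

open import Level using (0ℓ)
open import Data.Nat as ℕ using (zero; suc; z≤n; s≤s)
import Data.Nat.Properties as ℕ
open import Data.Nat.Divisibility as ℕ∣ using (>⇒∤)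
open import Data.Integer as ℤ using (ℤ; -_; _+_; _*_; _-_)
import Data.Integer.Properties as ℤ
import Data.Integer.DivMod as ℤ
open import Data.Integer.Tactic.RingSolver using (solve-∀)
open import Data.Integer.Divisibility.Signed as ∣ using (_∣_; divides)
open import Data.List using (List; []; _∷_; length; drop; applyUpTo)
open import Data.List.Properties using (length-applyUpTo)
open import Function using (_∘_)
open import Data.Sum using (_⊎_; inj₁; inj₂)
open import Relation.Nullary using (¬_; yes; no)
open import Data.Empty using (⊥-elim)
open import Relation.Binary.Bundles using (Setoid)
open import Relation.Binary.PropositionalEquality
open import Relation.Binary.Definitions using (tri<; tri≈; tri>)
import Relation.Binary.Reasoning.Setoid

-- Coefficientwise equality and the ring laws of polynomials

-- Records rather than ∀-types, so that the indices can be inferred from a proof.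
infix 4 _≈_
record _≈_ (f g : Poly) : Set where
  constructor coeffwise
  field coeff-≡ : ∀ i → coeff f i ≡ coeff g i
open _≈_

≈-refl : ∀ {f} → f ≈ f
≈-refl = coeffwise λ _ → refl

≈-sym : ∀ {f g} → f ≈ g → g ≈ f
≈-sym (coeffwise e) = coeffwise λ i → sym (e i)

≈-trans : ∀ {f g h} → f ≈ g → g ≈ h → f ≈ h
≈-trans (coeffwise e) (coeffwise e′) = coeffwise λ i → trans (e i) (e′ i)

≈-setoid : Setoid 0ℓ 0ℓ
≈-setoid = record
  { Carrier = Poly ; _≈_ = _≈_
  ; isEquivalence = record { refl = ≈-refl ; sym = ≈-sym ; trans = ≈-trans } }

module ≈-Reasoning = Relation.Binary.Reasoning.Setoid ≈-setoid

coeff-⊕ : ∀ f g i → coeff (f ⊕ g) i ≡ coeff f i + coeff g i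
coeff-⊕ []      g       i       = sym (ℤ.+-identityˡ _)
coeff-⊕ (a ∷ f) []      i       = sym (ℤ.+-identityʳ _)
coeff-⊕ (a ∷ f) (b ∷ g) zero    = refl
coeff-⊕ (a ∷ f) (b ∷ g) (suc i) = coeff-⊕ f g i

coeff-· : ∀ c f i → coeff (c · f) i ≡ c * coeff f i
coeff-· c []      i       = sym (ℤ.*-zeroʳ c)
coeff-· c (a ∷ f) zero    = refl
coeff-· c (a ∷ f) (suc i) = coeff-· c f i

⊕-cong : ∀ {f f′ g g′} → f ≈ f′ → g ≈ g′ → f ⊕ g ≈ f′ ⊕ g′
⊕-cong {f} {f′} {g} {g′} (coeffwise e) (coeffwise e′) = coeffwise λ i → begin
  coeff (f ⊕ g) i           ≡⟨ coeff-⊕ f g i ⟩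
  coeff f i + coeff g i     ≡⟨ cong₂ _+_ (e i) (e′ i) ⟩
  coeff f′ i + coeff g′ i   ≡⟨ coeff-⊕ f′ g′ i ⟨
  coeff (f′ ⊕ g′) i         ∎
  where open ≡-Reasoning

⊕-congˡ : ∀ f {g g′} → g ≈ g′ → f ⊕ g ≈ f ⊕ g′
⊕-congˡ f = ⊕-cong (≈-refl {f})

∷-cong : ∀ {a b f g} → a ≡ b → f ≈ g → a ∷ f ≈ b ∷ g
∷-cong a≡b (coeffwise e) = coeffwise λ where
  zero    → a≡b
  (suc i) → e i

⊕-comm : ∀ f g → f ⊕ g ≈ g ⊕ f
⊕-comm f g = coeffwise λ i → begin
  coeff (f ⊕ g) i       ≡⟨ coeff-⊕ f g i ⟩
  coeff f i + coeff g i ≡⟨ ℤ.+-comm (coeff f i) _ ⟩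
  coeff g i + coeff f i ≡⟨ coeff-⊕ g f i ⟨
  coeff (g ⊕ f) i       ∎
  where open ≡-Reasoning

⊕-assoc : ∀ f g h → (f ⊕ g) ⊕ h ≈ f ⊕ (g ⊕ h)
⊕-assoc f g h = coeffwise λ i → begin
  coeff ((f ⊕ g) ⊕ h) i               ≡⟨ coeff-⊕ (f ⊕ g) h i ⟩
  coeff (f ⊕ g) i + coeff h i         ≡⟨ cong (_+ coeff h i) (coeff-⊕ f g i) ⟩
  coeff f i + coeff g i + coeff h i   ≡⟨ ℤ.+-assoc (coeff f i) _ _ ⟩
  coeff f i + (coeff g i + coeff h i) ≡⟨ cong (_+_ (coeff f i)) (coeff-⊕ g h i) ⟨
  coeff f i + coeff (g ⊕ h) i         ≡⟨ coeff-⊕ f (g ⊕ h) i ⟨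
  coeff (f ⊕ (g ⊕ h)) i               ∎
  where open ≡-Reasoning

⊕-identityʳ : ∀ f → f ⊕ [] ≈ f
⊕-identityʳ f = coeffwise λ i → trans (coeff-⊕ f [] i) (ℤ.+-identityʳ _)

⊕-interchange : ∀ f g h k → (f ⊕ g) ⊕ (h ⊕ k) ≈ (f ⊕ h) ⊕ (g ⊕ k)
⊕-interchange f g h k = begin
  (f ⊕ g) ⊕ (h ⊕ k) ≈⟨ ⊕-assoc f g (h ⊕ k) ⟩
  f ⊕ (g ⊕ (h ⊕ k)) ≈⟨ ⊕-congˡ f (⊕-assoc g h k) ⟨
  f ⊕ ((g ⊕ h) ⊕ k) ≈⟨ ⊕-congˡ f (⊕-cong (⊕-comm g h) (≈-refl {k})) ⟩
  f ⊕ ((h ⊕ g) ⊕ k) ≈⟨ ⊕-congˡ f (⊕-assoc h g k) ⟩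
  f ⊕ (h ⊕ (g ⊕ k)) ≈⟨ ⊕-assoc f h (g ⊕ k) ⟨
  (f ⊕ h) ⊕ (g ⊕ k) ∎
  where open ≈-Reasoning

·-cong : ∀ c {f g} → f ≈ g → c · f ≈ c · g
·-cong c {f} {g} (coeffwise e) = coeffwise λ i →
  trans (coeff-· c f i) (trans (cong (c *_) (e i)) (sym (coeff-· c g i)))

·-distribˡ-⊕ : ∀ c f g → c · (f ⊕ g) ≈ (c · f) ⊕ (c · g)
·-distribˡ-⊕ c []      g       = ≈-refl
·-distribˡ-⊕ c (a ∷ f) []      = ≈-refl
·-distribˡ-⊕ c (a ∷ f) (b ∷ g) = ∷-cong (ℤ.*-distribˡ-+ c a b) (·-distribˡ-⊕ c f g)

·-distribʳ-+ : ∀ a b f → (a + b) · f ≈ (a · f) ⊕ (b · f)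
·-distribʳ-+ a b []      = ≈-refl
·-distribʳ-+ a b (c ∷ f) = ∷-cong (ℤ.*-distribʳ-+ c a b) (·-distribʳ-+ a b f)

·-comm-· : ∀ a b f → a · (b · f) ≈ b · (a · f)
·-comm-· a b []      = ≈-refl
·-comm-· a b (c ∷ f) = ∷-cong (swap a b c) (·-comm-· a b f)
  where swap : ∀ a b c → a * (b * c) ≡ b * (a * c)
        swap = solve-∀

·-assoc : ∀ a b f → (a * b) · f ≈ a · (b · f)
·-assoc a b []      = ≈-refl
·-assoc a b (c ∷ f) = ∷-cong (ℤ.*-assoc a b c) (·-assoc a b f)

·-∷-zero : ∀ c f → c · (+ 0 ∷ f) ≈ + 0 ∷ c · f
·-∷-zero c f = ∷-cong (ℤ.*-zeroʳ c) ≈-refl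

zero-·-⊕ : ∀ f g → ((+ 0) · f) ⊕ g ≈ g
zero-·-⊕ f g = coeffwise λ i → begin
  coeff (((+ 0) · f) ⊕ g) i           ≡⟨ coeff-⊕ ((+ 0) · f) g i ⟩
  coeff ((+ 0) · f) i + coeff g i     ≡⟨ cong (_+ coeff g i) (trans (coeff-· (+ 0) f i) (ℤ.*-zeroˡ (coeff f i))) ⟩
  + 0 + coeff g i                   ≡⟨ ℤ.+-identityˡ (coeff g i) ⟩
  coeff g i                         ∎
  where open ≡-Reasoning

one : Poly
one = + 1 ∷ []

⊗-identityˡ : ∀ f → one ⊗ f ≈ f
⊗-identityˡ f = coeffwise λ i → begin
  coeff (((+ 1) · f) ⊕ (+ 0 ∷ [])) i        ≡⟨ coeff-⊕ ((+ 1) · f) _ i ⟩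
  coeff ((+ 1) · f) i + coeff (+ 0 ∷ []) i  ≡⟨ cong₂ _+_ (coeff-· (+ 1) f i) (coeff-zero i) ⟩
  + 1 * coeff f i + + 0                     ≡⟨ ℤ.+-identityʳ _ ⟩
  + 1 * coeff f i                           ≡⟨ ℤ.*-identityˡ _ ⟩
  coeff f i                                 ∎
  where
  open ≡-Reasoning
  coeff-zero : ∀ i → coeff (+ 0 ∷ []) i ≡ + 0
  coeff-zero zero    = refl
  coeff-zero (suc i) = refl

⊗-congˡ : ∀ f {g g′} → g ≈ g′ → f ⊗ g ≈ f ⊗ g′
⊗-congˡ []      e = ≈-refl
⊗-congˡ (a ∷ f) e = ⊕-cong (·-cong a e) (∷-cong refl (⊗-congˡ f e))


⊗-constant : ∀ f c → f ⊗ (c ∷ []) ≈ c · f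
⊗-constant []      c = ≈-refl
⊗-constant (a ∷ f) c = ∷-cong (trans (ℤ.+-identityʳ (a * c)) (ℤ.*-comm a c)) (⊗-constant f c)

⊗-distribˡ-⊕ : ∀ f g h → f ⊗ (g ⊕ h) ≈ (f ⊗ g) ⊕ (f ⊗ h)
⊗-distribˡ-⊕ []      g h = ≈-refl
⊗-distribˡ-⊕ (a ∷ f) g h = begin
  (a · (g ⊕ h)) ⊕ (+ 0 ∷ f ⊗ (g ⊕ h))
    ≈⟨ ⊕-cong (·-distribˡ-⊕ a g h) (∷-cong refl (⊗-distribˡ-⊕ f g h)) ⟩
  ((a · g) ⊕ (a · h)) ⊕ ((+ 0 ∷ f ⊗ g) ⊕ (+ 0 ∷ f ⊗ h))
    ≈⟨ ⊕-interchange (a · g) (a · h) _ _ ⟩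
  ((a · g) ⊕ (+ 0 ∷ f ⊗ g)) ⊕ ((a · h) ⊕ (+ 0 ∷ f ⊗ h)) ∎
  where open ≈-Reasoning

⊗-distribʳ-⊕ : ∀ f g h → (f ⊕ g) ⊗ h ≈ (f ⊗ h) ⊕ (g ⊗ h)
⊗-distribʳ-⊕ []      g       h = ≈-refl
⊗-distribʳ-⊕ (a ∷ f) []      h = ≈-sym (⊕-identityʳ ((a ∷ f) ⊗ h))
⊗-distribʳ-⊕ (a ∷ f) (b ∷ g) h = begin
  ((a + b) · h) ⊕ (+ 0 ∷ (f ⊕ g) ⊗ h)
    ≈⟨ ⊕-cong (·-distribʳ-+ a b h) (∷-cong refl (⊗-distribʳ-⊕ f g h)) ⟩
  ((a · h) ⊕ (b · h)) ⊕ ((+ 0 ∷ f ⊗ h) ⊕ (+ 0 ∷ g ⊗ h))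
    ≈⟨ ⊕-interchange (a · h) (b · h) _ _ ⟩
  ((a · h) ⊕ (+ 0 ∷ f ⊗ h)) ⊕ ((b · h) ⊕ (+ 0 ∷ g ⊗ h)) ∎
  where open ≈-Reasoning

⊗-·-comm : ∀ f c g → f ⊗ (c · g) ≈ c · (f ⊗ g)
⊗-·-comm []      c g = ≈-refl
⊗-·-comm (a ∷ f) c g = begin
  (a · (c · g)) ⊕ (+ 0 ∷ f ⊗ (c · g)) ≈⟨ ⊕-cong (·-comm-· a c g) (∷-cong refl (⊗-·-comm f c g)) ⟩
  (c · (a · g)) ⊕ (+ 0 ∷ c · (f ⊗ g)) ≈⟨ ⊕-congˡ (c · (a · g)) (·-∷-zero c (f ⊗ g)) ⟨
  (c · (a · g)) ⊕ (c · (+ 0 ∷ f ⊗ g)) ≈⟨ ·-distribˡ-⊕ c (a · g) _ ⟨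
  c · ((a · g) ⊕ (+ 0 ∷ f ⊗ g))       ∎
  where open ≈-Reasoning

·-⊗-assoc : ∀ c f g → (c · f) ⊗ g ≈ c · (f ⊗ g)
·-⊗-assoc c []      g = ≈-refl
·-⊗-assoc c (a ∷ f) g = begin
  ((c * a) · g) ⊕ (+ 0 ∷ (c · f) ⊗ g) ≈⟨ ⊕-cong (·-assoc c a g) (∷-cong refl (·-⊗-assoc c f g)) ⟩
  (c · (a · g)) ⊕ (+ 0 ∷ c · (f ⊗ g)) ≈⟨ ⊕-congˡ (c · (a · g)) (·-∷-zero c (f ⊗ g)) ⟨
  (c · (a · g)) ⊕ (c · (+ 0 ∷ f ⊗ g)) ≈⟨ ·-distribˡ-⊕ c (a · g) _ ⟨
  c · ((a · g) ⊕ (+ 0 ∷ f ⊗ g))       ∎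
  where open ≈-Reasoning

⊗-assoc : ∀ f g h → (f ⊗ g) ⊗ h ≈ f ⊗ (g ⊗ h)
⊗-assoc []      g h = ≈-refl
⊗-assoc (a ∷ f) g h = begin
  ((a · g) ⊕ (+ 0 ∷ f ⊗ g)) ⊗ h                      ≈⟨ ⊗-distribʳ-⊕ (a · g) _ h ⟩
  ((a · g) ⊗ h) ⊕ (((+ 0) · h) ⊕ (+ 0 ∷ (f ⊗ g) ⊗ h)) ≈⟨ ⊕-cong (·-⊗-assoc a g h) (zero-·-⊕ h _) ⟩
  (a · (g ⊗ h)) ⊕ (+ 0 ∷ (f ⊗ g) ⊗ h)                ≈⟨ ⊕-congˡ (a · (g ⊗ h)) (∷-cong refl (⊗-assoc f g h)) ⟩
  (a · (g ⊗ h)) ⊕ (+ 0 ∷ f ⊗ (g ⊗ h))                ∎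
  where open ≈-Reasoning

length-⊕ : ∀ {k} f g → length f ≤ k → length g ≤ k → length (f ⊕ g) ≤ k
length-⊕ []      g       _         g≤k       = g≤k
length-⊕ (a ∷ f) []      f≤k       _         = f≤k
length-⊕ (a ∷ f) (b ∷ g) (s≤s f≤k) (s≤s g≤k) = s≤s (length-⊕ f g f≤k g≤k)

length-· : ∀ c f → length (c · f) ≡ length f
length-· c []      = refl
length-· c (a ∷ f) = cong suc (length-· c f)

length-⊗ : ∀ {m} f g → length g ≤ suc m → length (f ⊗ g) ≤ length f ℕ.+ m
length-⊗     []      g g≤1+m = z≤n
length-⊗ {m} (a ∷ f) g g≤1+m = length-⊕ (a · g) (+ 0 ∷ f ⊗ g)
  (subst (_≤ suc (length f ℕ.+ m)) (sym (length-· a g)) (ℕ.≤-trans g≤1+m (s≤s (ℕ.m≤n+m m (length f)))))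
  (s≤s (length-⊗ f g g≤1+m))

-- Evaluation

eval-⊕ : ∀ f g x → eval (f ⊕ g) x ≡ eval f x + eval g x
eval-⊕ []      g       x = sym (ℤ.+-identityˡ _)
eval-⊕ (a ∷ f) []      x = sym (ℤ.+-identityʳ _)
eval-⊕ (a ∷ f) (b ∷ g) x = begin
  a + b + x * eval (f ⊕ g) x             ≡⟨ cong (λ v → a + b + x * v) (eval-⊕ f g x) ⟩
  a + b + x * (eval f x + eval g x)      ≡⟨ regroup a b x (eval f x) (eval g x) ⟩
  a + x * eval f x + (b + x * eval g x)  ∎
  where
  open ≡-Reasoning
  regroup : ∀ a b x u v → a + b + x * (u + v) ≡ a + x * u + (b + x * v)
  regroup = solve-∀

eval-· : ∀ c f x → eval (c · f) x ≡ c * eval f x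
eval-· c []      x = sym (ℤ.*-zeroʳ c)
eval-· c (a ∷ f) x = begin
  c * a + x * eval (c · f) x  ≡⟨ cong (λ v → c * a + x * v) (eval-· c f x) ⟩
  c * a + x * (c * eval f x)  ≡⟨ regroup c a x (eval f x) ⟩
  c * (a + x * eval f x)      ∎
  where
  open ≡-Reasoning
  regroup : ∀ c a x u → c * a + x * (c * u) ≡ c * (a + x * u)
  regroup = solve-∀

eval-⊗ : ∀ f g x → eval (f ⊗ g) x ≡ eval f x * eval g x
eval-⊗ []      g x = refl
eval-⊗ (a ∷ f) g x = begin
  eval ((a · g) ⊕ (+ 0 ∷ f ⊗ g)) x            ≡⟨ eval-⊕ (a · g) _ x ⟩
  eval (a · g) x + (+ 0 + x * eval (f ⊗ g) x)  ≡⟨ cong₂ (λ u v → u + (+ 0 + x * v)) (eval-· a g x) (eval-⊗ f g x) ⟩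
  a * eval g x + (+ 0 + x * (eval f x * eval g x)) ≡⟨ regroup a x (eval f x) (eval g x) ⟩
  (a + x * eval f x) * eval g x                ∎
  where
  open ≡-Reasoning
  regroup : ∀ a x u v → a * v + (+ 0 + x * (u * v)) ≡ (a + x * u) * v
  regroup = solve-∀

eval-constant : ∀ c x → eval (c ∷ []) x ≡ c
eval-constant c x = trans (cong (_+_ c) (ℤ.*-zeroʳ x)) (ℤ.+-identityʳ c)

eval-^ₚ : ∀ f n x → eval (f ^ₚ n) x ≡ eval f x ℤ.^ n
eval-^ₚ f zero    x = eval-constant (+ 1) x
eval-^ₚ f (suc n) x = trans (eval-⊗ f (f ^ₚ n) x) (cong (eval f x *_) (eval-^ₚ f n x))

eval-linear : ∀ a x → eval (linear a) x ≡ x - a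
eval-linear a x = regroup a x
  where regroup : ∀ a x → - a + x * (+ 1 + x * + 0) ≡ x - a
        regroup = solve-∀

≈-drop₁ : ∀ {f g} → f ≈ g → drop 1 f ≈ drop 1 g
≈-drop₁ {[]}    {[]}    e = ≈-refl
≈-drop₁ {[]}    {b ∷ g} e = coeffwise λ i → coeff-≡ e (suc i)
≈-drop₁ {a ∷ f} {[]}    e = coeffwise λ i → coeff-≡ e (suc i)
≈-drop₁ {a ∷ f} {b ∷ g} e = coeffwise λ i → coeff-≡ e (suc i)

eval-≈[] : ∀ {g} x → [] ≈ g → eval g x ≡ + 0
eval-≈[] {[]}    x e = refl
eval-≈[] {b ∷ g} x e = begin
  b + x * eval g x  ≡⟨ cong₂ (λ u v → u + x * v) (sym (coeff-≡ e 0)) (eval-≈[] {g} x (≈-drop₁ e)) ⟩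
  + 0 + x * + 0     ≡⟨ cong (_+_ (+ 0)) (ℤ.*-zeroʳ x) ⟩
  + 0               ∎
  where open ≡-Reasoning

eval-cong : ∀ {f g} x → f ≈ g → eval f x ≡ eval g x
eval-cong {[]}    {g}     x e = sym (eval-≈[] x e)
eval-cong {a ∷ f} {[]}    x e = eval-≈[] x (≈-sym e)
eval-cong {a ∷ f} {b ∷ g} x e = cong₂ (λ u v → u + x * v) (coeff-≡ e 0) (eval-cong {f} {g} x (≈-drop₁ e))

-- Divisibility and congruences of integers

infix 4 _≡_[mod_]
record _≡_[mod_] (a b m : ℤ) : Set where
  constructor mod-∣
  field ∣-difference : m ∣ a - b
open _≡_[mod_]

mod-reflexive : ∀ {m a b} → a ≡ b → a ≡ b [mod m ]
mod-reflexive {m} {a} refl = mod-∣ (divides (+ 0) (ℤ.+-inverseʳ a))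

mod-refl : ∀ {m a} → a ≡ a [mod m ]
mod-refl = mod-reflexive refl

mod-sym : ∀ {m a b} → a ≡ b [mod m ] → b ≡ a [mod m ]
mod-sym {m} {a} {b} (mod-∣ m∣a-b) = mod-∣ (subst (m ∣_) (negate a b) (∣.∣m⇒∣-m m∣a-b))
  where negate : ∀ a b → - (a - b) ≡ b - a
        negate = solve-∀

mod-trans : ∀ {m a b c} → a ≡ b [mod m ] → b ≡ c [mod m ] → a ≡ c [mod m ]
mod-trans {m} {a} {b} {c} (mod-∣ m∣a-b) (mod-∣ m∣b-c) =
  mod-∣ (subst (m ∣_) (telescope a b c) (∣.∣m∣n⇒∣m+n m∣a-b m∣b-c))
  where telescope : ∀ a b c → (a - b) + (b - c) ≡ a - c
        telescope = solve-∀

mod-+ : ∀ {m a b c d} → a ≡ b [mod m ] → c ≡ d [mod m ] → a + c ≡ b + d [mod m ]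
mod-+ {m} {a} {b} {c} {d} (mod-∣ m∣a-b) (mod-∣ m∣c-d) =
  mod-∣ (subst (m ∣_) (regroup a b c d) (∣.∣m∣n⇒∣m+n m∣a-b m∣c-d))
  where regroup : ∀ a b c d → (a - b) + (c - d) ≡ (a + c) - (b + d)
        regroup = solve-∀

mod-* : ∀ {m a b c d} → a ≡ b [mod m ] → c ≡ d [mod m ] → a * c ≡ b * d [mod m ]
mod-* {m} {a} {b} {c} {d} (mod-∣ m∣a-b) (mod-∣ m∣c-d) =
  mod-∣ (subst (m ∣_) (regroup a b c d) (∣.∣m∣n⇒∣m+n (∣.∣m⇒∣m*n c m∣a-b) (∣.∣n⇒∣m*n b m∣c-d)))
  where regroup : ∀ a b c d → (a - b) * c + b * (c - d) ≡ a * c - b * d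
        regroup = solve-∀

mod-*-scale : ∀ {m a b} c → a ≡ b [mod m ] → c * a ≡ c * b [mod c * m ]
mod-*-scale {m} {a} {b} c (mod-∣ m∣a-b) =
  mod-∣ (subst (c * m ∣_) (distrib c a b) (∣.*-monoʳ-∣ c m∣a-b))
  where distrib : ∀ c a b → c * (a - b) ≡ c * a - c * b
        distrib = solve-∀

∣-resp-mod : ∀ {m a b} → a ≡ b [mod m ] → m ∣ b → m ∣ a
∣-resp-mod {m} {a} {b} (mod-∣ m∣a-b) m∣b = subst (m ∣_) (cancel a b) (∣.∣m∣n⇒∣m+n m∣a-b m∣b)
  where cancel : ∀ a b → (a - b) + b ≡ a
        cancel = solve-∀

eval-mod-point : ∀ {m x y} g → x ≡ y [mod m ] → eval g x ≡ eval g y [mod m ]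
eval-mod-point []      x≡y = mod-refl
eval-mod-point (a ∷ g) x≡y = mod-+ (mod-refl {a = a}) (mod-* x≡y (eval-mod-point g x≡y))

eval-mod-coeff : ∀ {m} f g x → (∀ i → coeff f i ≡ coeff g i [mod m ]) → eval f x ≡ eval g x [mod m ]
eval-mod-coeff []      []      x c = mod-refl
eval-mod-coeff []      (b ∷ g) x c =
  mod-trans (mod-reflexive (sym (cong (_+_ (+ 0)) (ℤ.*-zeroʳ x))))
            (mod-+ (c 0) (mod-* (mod-refl {a = x}) (eval-mod-coeff [] g x (c ∘ suc))))
eval-mod-coeff (a ∷ f) []      x c =
  mod-trans (mod-+ (c 0) (mod-* (mod-refl {a = x}) (eval-mod-coeff f [] x (c ∘ suc))))
            (mod-reflexive (cong (_+_ (+ 0)) (ℤ.*-zeroʳ x)))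
eval-mod-coeff (a ∷ f) (b ∷ g) x c = mod-+ (c 0) (mod-* (mod-refl {a = x}) (eval-mod-coeff f g x (c ∘ suc)))

∣-zero : ∀ m → m ∣ + 0
∣-zero m = divides (+ 0) refl

1∣ : ∀ x → + 1 ∣ x
1∣ x = divides x (sym (ℤ.*-identityʳ x))

∣-*-mono : ∀ {a b c e} → a ∣ b → c ∣ e → a * c ∣ b * e
∣-*-mono {a} {b} {c} {e} (divides u b≡ua) (divides v e≡vc) = divides (u * v) (begin
  b * e             ≡⟨ cong₂ _*_ b≡ua e≡vc ⟩
  u * a * (v * c)   ≡⟨ regroup u a v c ⟩
  u * v * (a * c)   ∎)
  where
  open ≡-Reasoning
  regroup : ∀ u a v c → u * a * (v * c) ≡ u * v * (a * c)
  regroup = solve-∀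

∣-^ : ∀ {a b} n → a ∣ b → a ℤ.^ n ∣ b ℤ.^ n
∣-^ zero    a∣b = ∣.∣-refl
∣-^ (suc n) a∣b = ∣-*-mono a∣b (∣-^ n a∣b)

pos-^ : ∀ m n → + (m ℕ.^ n) ≡ (+ m) ℤ.^ n
pos-^ m zero    = refl
pos-^ m (suc n) = trans (ℤ.pos-* m (m ℕ.^ n)) (cong (+ m *_) (pos-^ m n))

^-∣-^ : ∀ a {m n} → m ≤ n → a ℤ.^ m ∣ a ℤ.^ n
^-∣-^ a {m} {n} m≤n = divides (a ℤ.^ (n ℕ.∸ m))
  (trans (cong (a ℤ.^_) (sym (ℕ.m∸n+n≡m m≤n))) (ℤ.^-distribˡ-+-* a (n ℕ.∸ m) m))

euclidsLemmaℤ : ∀ {p} → Prime p → ∀ x y → + p ∣ x * y → + p ∣ x ⊎ + p ∣ y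
euclidsLemmaℤ {p} p-prime x y p∣xy
  with euclidsLemma ℤ.∣ x ∣ ℤ.∣ y ∣ p-prime (subst (p ℕ∣.∣_) (ℤ.abs-* x y) (∣.∣⇒∣ᵤ p∣xy))
... | inj₁ p∣x = inj₁ (∣.∣ᵤ⇒∣ p∣x)
... | inj₂ p∣y = inj₂ (∣.∣ᵤ⇒∣ p∣y)

prime∣*∤⇒∣ : ∀ {p} → Prime p → ∀ {x} y → ¬ (+ p ∣ x) → + p ∣ x * y → + p ∣ y
prime∣*∤⇒∣ p-prime {x} y p∤x p∣xy with euclidsLemmaℤ p-prime x y p∣xy
... | inj₁ p∣x = ⊥-elim (p∤x p∣x)
... | inj₂ p∣y = p∣y

∤-below : ∀ {p k} → 0 < k → k < p → ¬ (+ p ∣ + k)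
∤-below {k = suc k} 0<k k<p p∣k = >⇒∤ k<p (∣.∣⇒∣ᵤ p∣k)

∤-gap : ∀ {p a k} → k < a → a < p → ¬ (+ p ∣ + a - + k)
∤-gap {p} {a} {k} k<a a<p p∣a-k = ∤-below (ℕ.m<n⇒0<n∸m k<a) (ℕ.≤-<-trans (ℕ.m∸n≤m a k) a<p)
  (subst (+ p ∣_) (trans (ℤ.m-n≡m⊖n a k) (ℤ.⊖-≥ (ℕ.<⇒≤ k<a))) p∣a-k)

∤-difference : ∀ {p a k} → a < p → k < p → a ≢ k → ¬ (+ p ∣ + a - + k)
∤-difference {p} {a} {k} a<p k<p a≢k p∣a-k with ℕ.<-cmp k a
... | tri< k<a _ _ = ∤-gap k<a a<p p∣a-k
... | tri≈ _ k≡a _ = a≢k (sym k≡a)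
... | tri> _ _ a<k = ∤-gap a<k k<p (∣-difference (mod-sym {a = + a} {b = + k} (mod-∣ p∣a-k)))

prime∤1 : ∀ {p} → Prime p → ¬ (+ p ∣ + 1)
prime∤1 p-prime = ∤-below ℕ.z<s (ℕ.nonTrivial⇒n>1 _ {{prime⇒nonTrivial p-prime}})

prime∤^ : ∀ {p} → Prime p → ∀ {c} n → ¬ (+ p ∣ c) → ¬ (+ p ∣ c ℤ.^ n)
prime∤^ p-prime     zero    p∤c = prime∤1 p-prime
prime∤^ p-prime {c} (suc n) p∤c p∣cⁿ⁺¹ =
  prime∤^ p-prime n p∤c (prime∣*∤⇒∣ p-prime (c ℤ.^ n) p∤c p∣cⁿ⁺¹)

-- Polynomials with all coefficients divisible by m

infix 4 _∣ₚ_
_∣ₚ_ : ℤ → Poly → Set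
m ∣ₚ f = ∀ i → m ∣ coeff f i

∣ₚ-resp-≈ : ∀ {m f g} → f ≈ g → m ∣ₚ f → m ∣ₚ g
∣ₚ-resp-≈ {m} (coeffwise e) m∣f i = subst (m ∣_) (e i) (m∣f i)

∣ₚ-constant : ∀ {m a} → m ∣ a → m ∣ₚ (a ∷ [])
∣ₚ-constant m∣a zero    = m∣a
∣ₚ-constant {m} m∣a (suc i) = ∣-zero m

∣ₚ-⊕ : ∀ {m} f g → m ∣ₚ f → m ∣ₚ g → m ∣ₚ (f ⊕ g)
∣ₚ-⊕ {m} f g m∣f m∣g i = subst (m ∣_) (sym (coeff-⊕ f g i)) (∣.∣m∣n⇒∣m+n (m∣f i) (m∣g i))

∣ₚ-· : ∀ {m} c f → m ∣ₚ f → m ∣ₚ (c · f)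
∣ₚ-· {m} c f m∣f i = subst (m ∣_) (sym (coeff-· c f i)) (∣.∣n⇒∣m*n c (m∣f i))

∣ₚ-·-scale : ∀ {m} c f → m ∣ₚ f → c * m ∣ₚ (c · f)
∣ₚ-·-scale {m} c f m∣f i = subst (c * m ∣_) (sym (coeff-· c f i)) (∣.*-monoʳ-∣ c (m∣f i))

∣ₚ-⊗ : ∀ {m} f g → m ∣ₚ g → m ∣ₚ (f ⊗ g)
∣ₚ-⊗ {m} []      g m∣g i       = ∣-zero m
∣ₚ-⊗ {m} (a ∷ f) g m∣g = ∣ₚ-⊕ (a · g) (+ 0 ∷ f ⊗ g) (∣ₚ-· a g m∣g) shifted
  where shifted : m ∣ₚ (+ 0 ∷ f ⊗ g)
        shifted zero    = ∣-zero m
        shifted (suc i) = ∣ₚ-⊗ f g m∣g i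

∣ₚ⇒quotient : ∀ m f → m ∣ₚ f → Σ Poly λ g → f ≈ m · g × length g ≡ length f
∣ₚ⇒quotient m []      m∣f = [] , ≈-refl , refl
∣ₚ⇒quotient m (a ∷ f) m∣f with ∣ₚ⇒quotient m f (m∣f ∘ suc) | m∣f 0
... | g , f≈m·g , length-g | divides q a≡q*m =
  q ∷ g , ∷-cong (trans a≡q*m (ℤ.*-comm q m)) f≈m·g , cong suc length-g

≈⊕∣ₚ⇒≡ₚ : ∀ {m} f g h → f ≈ g ⊕ h → m ∣ₚ g → f ≡ₚ h [mod m ]
≈⊕∣ₚ⇒≡ₚ {m} f g h f≈g⊕h m∣g i = ∣.∣⇒∣ᵤ (subst (m ∣_) (sym coeff-difference) (m∣g i))
  where
  cancel : ∀ u v → (u + v) - v ≡ u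
  cancel = solve-∀
  coeff-difference : coeff f i - coeff h i ≡ coeff g i
  coeff-difference = trans (cong (_- coeff h i) (trans (coeff-≡ f≈g⊕h i) (coeff-⊕ g h i))) (cancel _ _)

-- Division by x − b and roots modulo a prime

linear-⊗ : ∀ b g → linear b ⊗ g ≈ ((- b) · g) ⊕ (+ 0 ∷ g)
linear-⊗ b g = ⊕-congˡ ((- b) · g) (∷-cong refl (⊗-identityˡ g))

tailValues : ℤ → Poly → Poly
tailValues b []      = []
tailValues b (c ∷ h) = eval (c ∷ h) b ∷ tailValues b h

length-tailValues : ∀ b h → length (tailValues b h) ≡ length h
length-tailValues b []      = refl
length-tailValues b (c ∷ h) = cong suc (length-tailValues b h)

-- Synthetic division: the coefficients of the quotient of g by x − b are the values at b of the proper tails of g.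
quotientByLinear : ℤ → Poly → Poly
quotientByLinear b g = tailValues b (drop 1 g)

linear-division : ∀ b g → g ≈ (eval g b ∷ []) ⊕ (linear b ⊗ quotientByLinear b g)
linear-division b g = ≈-trans (coeffwise λ i → trans (coefficients g i) (sym (expand (eval g b) _ i)))
  (≈-sym (⊕-congˡ (eval g b ∷ []) (linear-⊗ b (quotientByLinear b g))))
  where
  expand : ∀ c S i → coeff ((c ∷ []) ⊕ (((- b) · S) ⊕ (+ 0 ∷ S))) i
                   ≡ coeff (c ∷ []) i + (- b * coeff S i + coeff (+ 0 ∷ S) i)
  expand c S i = trans (coeff-⊕ (c ∷ []) (((- b) · S) ⊕ (+ 0 ∷ S)) i)
    (cong (_+_ (coeff (c ∷ []) i))
      (trans (coeff-⊕ ((- b) · S) (+ 0 ∷ S) i) (cong (_+ coeff (+ 0 ∷ S) i) (coeff-· (- b) S i))))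
  coeff₀ : ∀ h → coeff (tailValues b h) 0 ≡ eval h b
  coeff₀ []      = refl
  coeff₀ (c ∷ h) = refl
  coeffₛ : ∀ h i → coeff h i ≡ + 0 + (- b * coeff (tailValues b h) (suc i) + coeff (tailValues b h) i)
  coeffₛ []      i       = zeros b
    where zeros : ∀ b → + 0 ≡ + 0 + (- b * + 0 + + 0)
          zeros = solve-∀
  coeffₛ (c ∷ h) zero    =
    trans (regroup c b (eval h b)) (cong (λ u → + 0 + (- b * u + eval (c ∷ h) b)) (sym (coeff₀ h)))
    where regroup : ∀ c b u → c ≡ + 0 + (- b * u + (c + b * u))
          regroup = solve-∀
  coeffₛ (c ∷ h) (suc i) = coeffₛ h i
  coefficients : ∀ g i → coeff g i ≡ coeff (eval g b ∷ []) i
                           + (- b * coeff (quotientByLinear b g) i + coeff (+ 0 ∷ quotientByLinear b g) i)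
  coefficients []      zero    = coeffₛ [] 0
  coefficients []      (suc i) = coeffₛ [] i
  coefficients (a ∷ h) zero    = trans (regroup a b (eval h b))
    (cong (λ u → a + b * eval h b + (- b * u + + 0)) (sym (coeff₀ h)))
    where regroup : ∀ a b u → a ≡ a + b * u + (- b * u + + 0)
          regroup = solve-∀
  coefficients (a ∷ h) (suc i) = coeffₛ h i

eval-linear-division : ∀ b g y → eval g y ≡ eval g b + (y - b) * eval (quotientByLinear b g) y
eval-linear-division b g y = begin
  eval g y                                        ≡⟨ eval-cong y (linear-division b g) ⟩
  eval ((eval g b ∷ []) ⊕ (linear b ⊗ S)) y       ≡⟨ eval-⊕ (eval g b ∷ []) (linear b ⊗ S) y ⟩
  eval (eval g b ∷ []) y + eval (linear b ⊗ S) y  ≡⟨ cong₂ _+_ (eval-constant (eval g b) y)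
                                                         (trans (eval-⊗ (linear b) S y) (cong (_* eval S y) (eval-linear b y))) ⟩
  eval g b + (y - b) * eval S y                   ∎
  where
  open ≡-Reasoning
  S : Poly
  S = quotientByLinear b g

roots⇒∣ₚ : ∀ {p} → Prime p → ∀ L g b → L ≤ p → length g ≤ L →
           (∀ i → i < L → + p ∣ eval g (b + + i)) → + p ∣ₚ g
roots⇒∣ₚ p-prime L       []      b L≤p length≤L roots = λ _ → ∣-zero _
roots⇒∣ₚ {p} p-prime (suc L) (a ∷ h) b L≤p (s≤s length≤L) roots =
  ∣ₚ-resp-≈ (≈-sym (linear-division b (a ∷ h)))
    (∣ₚ-⊕ (eval (a ∷ h) b ∷ []) (linear b ⊗ S) (∣ₚ-constant p∣g[b]) (∣ₚ-⊗ (linear b) S p∣S))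
  where
  S : Poly
  S = tailValues b h
  p∣g[b] : + p ∣ eval (a ∷ h) b
  p∣g[b] = subst (λ z → + p ∣ eval (a ∷ h) z) (ℤ.+-identityʳ b) (roots 0 (s≤s z≤n))
  p∣[1+i]·S : ∀ i → i < L → + p ∣ + suc i * eval S (b + + suc i)
  p∣[1+i]·S i i<L = subst (λ z → + p ∣ z * eval S y) (shift b (+ suc i))
    (∣.∣m+n∣m⇒∣n (subst (+ p ∣_) (eval-linear-division b (a ∷ h) y) (roots (suc i) (s≤s i<L))) p∣g[b])
    where
    y : ℤ
    y = b + + suc i
    shift : ∀ b k → (b + k) - b ≡ k
    shift = solve-∀
  p∣S-at : ∀ i → i < L → + p ∣ eval S ((b + + 1) + + i)
  p∣S-at i i<L = subst (λ z → + p ∣ eval S z) (sym (ℤ.+-assoc b (+ 1) (+ i)))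
    (prime∣*∤⇒∣ p-prime (eval S (b + + suc i)) (∤-below ℕ.z<s (ℕ.<-≤-trans (s≤s i<L) L≤p))
      (p∣[1+i]·S i i<L))
  p∣S : + p ∣ₚ S
  p∣S = roots⇒∣ₚ p-prime L S (b + + 1) (ℕ.≤-trans (ℕ.n≤1+n L) L≤p)
          (subst (_≤ L) (sym (length-tailValues b h)) length≤L) p∣S-at

-- The falling factorial

length-fallingPoly : ∀ k → length (fallingPoly k) ≤ suc k
length-fallingPoly zero    = s≤s z≤n
length-fallingPoly (suc k) = ℕ.≤-trans (length-⊗ (fallingPoly k) (linear (+ k)) (s≤s (s≤s z≤n)))
  (subst (_≤ suc (suc k)) (ℕ.+-comm 1 (length (fallingPoly k))) (s≤s (length-fallingPoly k)))

fallingPoly-division : ∀ k f → Σ Poly λ r → Σ Poly λ Q → length r ≤ k × f ≈ r ⊕ (fallingPoly k ⊗ Q)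
fallingPoly-division zero    f = [] , f , z≤n , ≈-sym (⊗-identityˡ f)
fallingPoly-division (suc k) f with fallingPoly-division k f
... | r , Q , r≤k , f≈ = r ⊕ (c · Fₖ) , Q′ , length-r′ , (begin
  f                                               ≈⟨ f≈ ⟩
  r ⊕ (Fₖ ⊗ Q)                                    ≈⟨ ⊕-congˡ r (⊗-congˡ Fₖ (linear-division (+ k) Q)) ⟩
  r ⊕ (Fₖ ⊗ ((c ∷ []) ⊕ (linear (+ k) ⊗ Q′)))     ≈⟨ ⊕-congˡ r (⊗-distribˡ-⊕ Fₖ (c ∷ []) _) ⟩
  r ⊕ ((Fₖ ⊗ (c ∷ [])) ⊕ (Fₖ ⊗ (linear (+ k) ⊗ Q′)))
    ≈⟨ ⊕-congˡ r (⊕-cong (⊗-constant Fₖ c) (≈-sym (⊗-assoc Fₖ (linear (+ k)) Q′))) ⟩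
  r ⊕ ((c · Fₖ) ⊕ (fallingPoly (suc k) ⊗ Q′))     ≈⟨ ⊕-assoc r (c · Fₖ) _ ⟨
  (r ⊕ (c · Fₖ)) ⊕ (fallingPoly (suc k) ⊗ Q′)     ∎)
  where
  open ≈-Reasoning
  Fₖ : Poly
  Fₖ = fallingPoly k
  c : ℤ
  c = eval Q (+ k)
  Q′ : Poly
  Q′ = quotientByLinear (+ k) Q
  length-r′ : length (r ⊕ (c · Fₖ)) ≤ suc k
  length-r′ = length-⊕ r (c · Fₖ) (ℕ.m≤n⇒m≤1+n r≤k)
    (subst (_≤ suc k) (sym (length-· c Fₖ)) (length-fallingPoly k))

hornerₚ : Poly → (ℕ → Poly) → ℕ → Poly
hornerₚ F r zero    = r 0
hornerₚ F r (suc m) = r 0 ⊕ (F ⊗ hornerₚ F (r ∘ suc) m)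

fallingPoly-expansion : ∀ k m f → Σ (ℕ → Poly) λ r →
  (∀ n → n < m → length (r n) ≤ k) × f ≈ hornerₚ (fallingPoly k) r m
fallingPoly-expansion k zero    f = (λ _ → f) , (λ _ ()) , ≈-refl
fallingPoly-expansion k (suc m) f with fallingPoly-division k f
... | r₀ , Q , r₀≤k , f≈ with fallingPoly-expansion k m Q
...   | r , r≤k , Q≈ = r′ , r′≤k , ≈-trans f≈ (⊕-congˡ r₀ (⊗-congˡ (fallingPoly k) Q≈))
  where
  r′ : ℕ → Poly
  r′ zero    = r₀
  r′ (suc n) = r n
  r′≤k : ∀ n → n < suc m → length (r′ n) ≤ k
  r′≤k zero    _         = r₀≤k
  r′≤k (suc n) (s≤s n<m) = r≤k n n<m

fallingExcept : ℕ → ℕ → ℤ → ℤ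
fallingExcept zero    a x = + 1
fallingExcept (suc k) a x with k ℕ.≟ a
... | yes _ = fallingExcept k a x
... | no  _ = fallingExcept k a x * (x - + k)

eval-fallingPoly-suc : ∀ k x → eval (fallingPoly (suc k)) x ≡ eval (fallingPoly k) x * (x - + k)
eval-fallingPoly-suc k x =
  trans (eval-⊗ (fallingPoly k) (linear (+ k)) x) (cong (eval (fallingPoly k) x *_) (eval-linear (+ k) x))

fallingPoly≡fallingExcept : ∀ {k a} x → k ≤ a → eval (fallingPoly k) x ≡ fallingExcept k a x
fallingPoly≡fallingExcept {zero}      x _ = eval-constant (+ 1) x
fallingPoly≡fallingExcept {suc k} {a} x k<a with k ℕ.≟ a
... | yes refl = ⊥-elim (ℕ.<-irrefl refl k<a)
... | no  _    = trans (eval-fallingPoly-suc k x) (cong (_* (x - + k)) (fallingPoly≡fallingExcept x (ℕ.<⇒≤ k<a)))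

fallingPoly-factor : ∀ {k a} x → a < k → eval (fallingPoly k) x ≡ (x - + a) * fallingExcept k a x
fallingPoly-factor {suc k} {a} x a<1+k with k ℕ.≟ a
... | yes refl = trans (eval-fallingPoly-suc k x)
                   (trans (cong (_* (x - + k)) (fallingPoly≡fallingExcept {k} {k} x ℕ.≤-refl)) (ℤ.*-comm _ (x - + k)))
... | no  k≢a  = begin
  eval (fallingPoly (suc k)) x                  ≡⟨ eval-fallingPoly-suc k x ⟩
  eval (fallingPoly k) x * (x - + k)            ≡⟨ cong (_* (x - + k)) (fallingPoly-factor x a<k) ⟩
  (x - + a) * fallingExcept k a x * (x - + k)   ≡⟨ ℤ.*-assoc (x - + a) _ _ ⟩
  (x - + a) * (fallingExcept k a x * (x - + k)) ∎
  where
  open ≡-Reasoning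
  a<k : a < k
  a<k = ℕ.≤∧≢⇒< (ℕ.≤-pred a<1+k) (k≢a ∘ sym)

fallingExcept-mod : ∀ {m x y} k a → x ≡ y [mod m ] → fallingExcept k a x ≡ fallingExcept k a y [mod m ]
fallingExcept-mod zero    a x≡y = mod-refl
fallingExcept-mod (suc k) a x≡y with k ℕ.≟ a
... | yes _ = fallingExcept-mod k a x≡y
... | no  _ = mod-* (fallingExcept-mod k a x≡y) (mod-+ x≡y (mod-refl {a = - + k}))

prime∤fallingExcept : ∀ {p} → Prime p → ∀ {k a} → k ≤ p → a < p → ¬ (+ p ∣ fallingExcept k a (+ a))
prime∤fallingExcept p-prime {zero}      _   _   = prime∤1 p-prime
prime∤fallingExcept p-prime {suc k} {a} k<p a<p p∣E with k ℕ.≟ a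
... | yes _   = prime∤fallingExcept p-prime (ℕ.<⇒≤ k<p) a<p p∣E
... | no  k≢a with euclidsLemmaℤ p-prime (fallingExcept k a (+ a)) (+ a - + k) p∣E
...   | inj₁ p∣E′  = prime∤fallingExcept p-prime (ℕ.<⇒≤ k<p) a<p p∣E′
...   | inj₂ p∣a-k = ∤-difference a<p k<p (k≢a ∘ sym) p∣a-k

prime∣fallingPoly : ∀ {p} → Prime p → ∀ x → + p ∣ eval (fallingPoly p) x
prime∣fallingPoly {p} p-prime x =
  subst (+ p ∣_) (sym (fallingPoly-factor x (ℤ.n%d<d x (+ p)))) (∣.∣m⇒∣m*n _ p∣x-r)
  where
  instance
    p≢0 : ℕ.NonZero p
    p≢0 = prime⇒nonZero p-prime
  cancel : ∀ r u → (r + u) - r ≡ u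
  cancel = solve-∀
  p∣x-r : + p ∣ x - + (x ℤ.% + p)
  p∣x-r = divides (x ℤ./ + p)
    (trans (cong (_- + (x ℤ.% + p)) (ℤ.a≡a%n+[a/n]*n x (+ p))) (cancel (+ (x ℤ.% + p)) (x ℤ./ + p * + p)))

-- Horner sums

horner : (ℕ → ℤ) → ℤ → ℕ → ℤ
horner a x zero    = a 0
horner a x (suc m) = a 0 + x * horner (a ∘ suc) x m

eval-hornerₚ : ∀ F r m x → eval (hornerₚ F r m) x ≡ horner (λ n → eval (r n) x) (eval F x) m
eval-hornerₚ F r zero    x = refl
eval-hornerₚ F r (suc m) x = begin
  eval (r 0 ⊕ (F ⊗ hornerₚ F (r ∘ suc) m)) x            ≡⟨ eval-⊕ (r 0) _ x ⟩
  eval (r 0) x + eval (F ⊗ hornerₚ F (r ∘ suc) m) x     ≡⟨ cong (_+_ (eval (r 0) x)) (eval-⊗ F _ x) ⟩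
  eval (r 0) x + eval F x * eval (hornerₚ F (r ∘ suc) m) x
    ≡⟨ cong (λ v → eval (r 0) x + eval F x * v) (eval-hornerₚ F (r ∘ suc) m x) ⟩
  horner (λ n → eval (r n) x) (eval F x) (suc m)         ∎
  where open ≡-Reasoning

horner-cong : ∀ {a b} x k → (∀ n → a n ≡ b n) → horner a x k ≡ horner b x k
horner-cong x zero    a≡b = a≡b 0
horner-cong x (suc k) a≡b = cong₂ (λ u v → u + x * v) (a≡b 0) (horner-cong x k (a≡b ∘ suc))

horner-mod : ∀ {m} a b x y k → (∀ n → a n ≡ b n [mod m ]) → x ≡ y [mod m ] →
             horner a x k ≡ horner b y k [mod m ]
horner-mod a b x y zero    a≡b x≡y = a≡b 0
horner-mod a b x y (suc k) a≡b x≡y =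
  mod-+ (a≡b 0) (mod-* x≡y (horner-mod (a ∘ suc) (b ∘ suc) x y k (a≡b ∘ suc) x≡y))

horner-*ˡ : ∀ c b t k → c * horner b t k ≡ horner (λ n → c * b n) t k
horner-*ˡ c b t zero    = refl
horner-*ˡ c b t (suc k) = trans (distrib c (b 0) t _) (cong (λ v → c * b 0 + t * v) (horner-*ˡ c (b ∘ suc) t k))
  where distrib : ∀ c b t h → c * (b + t * h) ≡ c * b + t * (c * h)
        distrib = solve-∀

horner-*-point : ∀ a c t k → horner a (c * t) k ≡ horner (λ n → c ℤ.^ n * a n) t k
horner-*-point a c t zero    = sym (ℤ.*-identityˡ (a 0))
horner-*-point a c t (suc k) = begin
  a 0 + c * t * horner (a ∘ suc) (c * t) k               ≡⟨ cong (λ v → a 0 + c * t * v) (horner-*-point (a ∘ suc) c t k) ⟩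
  a 0 + c * t * horner (λ n → c ℤ.^ n * a (suc n)) t k   ≡⟨ regroup (a 0) c t _ ⟩
  + 1 * a 0 + t * (c * horner (λ n → c ℤ.^ n * a (suc n)) t k)
    ≡⟨ cong (λ v → + 1 * a 0 + t * v) (trans (horner-*ˡ c _ t k)
         (horner-cong t k λ n → sym (ℤ.*-assoc c (c ℤ.^ n) (a (suc n))))) ⟩
  horner (λ n → c ℤ.^ n * a n) t (suc k)                 ∎
  where
  open ≡-Reasoning
  regroup : ∀ a c t h → a + c * t * h ≡ + 1 * a + t * (c * h)
  regroup = solve-∀

-- The terms of index n > j are multiples of (Pψ)ⁿ, hence of Pʲ⁺¹.
horner-scaled : ∀ P ψ ρ σ {j m} → j ≤ m → (∀ n → ρ n ≡ P ℤ.^ (j ℕ.∸ n) * σ n) →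
                horner ρ (P * ψ) m ≡ P ℤ.^ j * horner σ ψ j [mod P ℤ.^ suc j ]
horner-scaled P ψ ρ σ {zero} {zero} _ ρ≡ = mod-reflexive (ρ≡ 0)
horner-scaled P ψ ρ σ {zero} {suc m} _ ρ≡ rewrite ρ≡ 0 =
  mod-∣ (divides (ψ * horner (ρ ∘ suc) (P * ψ) m) (regroup P ψ (σ 0) _))
  where regroup : ∀ P ψ s h → (+ 1 * s + P * ψ * h) - + 1 * s ≡ ψ * h * (P * + 1)
        regroup = solve-∀
horner-scaled P ψ ρ σ {suc j} {suc m} (s≤s j≤m) ρ≡ =
  mod-trans (mod-reflexive (cong₂ _+_ (ρ≡ 0) (ℤ.*-assoc P ψ _)))
    (mod-trans (mod-+ (mod-refl {a = P ℤ.^ suc j * σ 0}) (mod-*-scale P (mod-* (mod-refl {a = ψ}) tail≡)))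
      (mod-reflexive (regroup P (P ℤ.^ j) ψ (σ 0) (horner (σ ∘ suc) ψ j))))
  where
  tail≡ : horner (ρ ∘ suc) (P * ψ) m ≡ P ℤ.^ j * horner (σ ∘ suc) ψ j [mod P ℤ.^ suc j ]
  tail≡ = horner-scaled P ψ (ρ ∘ suc) (σ ∘ suc) j≤m (ρ≡ ∘ suc)
  regroup : ∀ P Pʲ ψ s h → P * Pʲ * s + P * (ψ * (Pʲ * h)) ≡ P * Pʲ * (s + ψ * h)
  regroup = solve-∀

eval-applyUpTo : ∀ a k x → eval (applyUpTo a (suc k)) x ≡ horner a x k
eval-applyUpTo a zero    x = eval-constant (a 0) x
eval-applyUpTo a (suc k) x = cong (λ v → a 0 + x * v) (eval-applyUpTo (a ∘ suc) k x)

coeff-applyUpTo : ∀ a {k n} → n < k → coeff (applyUpTo a k) n ≡ a n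
coeff-applyUpTo a {suc k} {zero}  _         = refl
coeff-applyUpTo a {suc k} {suc n} (s≤s n<k) = coeff-applyUpTo (a ∘ suc) n<k

powerSum : Poly → (ℕ → Poly) → ℕ → Poly
powerSum F r zero    = []
powerSum F r (suc m) = powerSum F r m ⊕ ((F ^ₚ suc m) ⊗ r (suc m))

powerSum-shift : ∀ F r m → F ⊗ (r 1 ⊕ powerSum F (r ∘ suc) m) ≈ powerSum F r (suc m)
powerSum-shift F r zero = begin
  F ⊗ (r 1 ⊕ [])     ≈⟨ ⊗-congˡ F (⊕-identityʳ (r 1)) ⟩
  F ⊗ r 1            ≈⟨ ⊗-congˡ F (⊗-identityˡ (r 1)) ⟨
  F ⊗ (one ⊗ r 1)    ≈⟨ ⊗-assoc F one (r 1) ⟨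
  (F ⊗ one) ⊗ r 1    ∎
  where open ≈-Reasoning
powerSum-shift F r (suc m) = begin
  F ⊗ (r 1 ⊕ (S ⊕ X))             ≈⟨ ⊗-congˡ F (⊕-assoc (r 1) S X) ⟨
  F ⊗ ((r 1 ⊕ S) ⊕ X)             ≈⟨ ⊗-distribˡ-⊕ F (r 1 ⊕ S) X ⟩
  (F ⊗ (r 1 ⊕ S)) ⊕ (F ⊗ X)       ≈⟨ ⊕-cong (powerSum-shift F r m) (≈-sym (⊗-assoc F (F ^ₚ suc m) _)) ⟩
  powerSum F r (suc (suc m))      ∎
  where
  open ≈-Reasoning
  S : Poly
  S = powerSum F (r ∘ suc) m
  X : Poly
  X = (F ^ₚ suc m) ⊗ r (suc (suc m))

hornerₚ≈powerSum : ∀ F r m → hornerₚ F r m ≈ r 0 ⊕ powerSum F r m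
hornerₚ≈powerSum F r zero    = ≈-sym (⊕-identityʳ (r 0))
hornerₚ≈powerSum F r (suc m) = ⊕-congˡ (r 0)
  (≈-trans (⊗-congˡ F (hornerₚ≈powerSum F (r ∘ suc) m)) (powerSum-shift F r m))

powerSum≈partialSum : ∀ p d q r m → (∀ n → r n ≈ (+ (p ℕ.^ (d ℕ.∸ n))) · q n) →
                      powerSum (fallingPoly p) r m ≈ partialSum p d q m
powerSum≈partialSum p d q r zero    r≈ = ≈-refl
powerSum≈partialSum p d q r (suc m) r≈ = ⊕-cong (powerSum≈partialSum p d q r m r≈)
  (≈-trans (⊗-congˡ (fallingPoly p ^ₚ suc m) (r≈ (suc m))) (⊗-·-comm (fallingPoly p ^ₚ suc m) _ (q (suc m))))

module NullExpansion {p} (p-prime : Prime p) {d} (d≤p : d ≤ p) (f : Poly)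
               (null : ∀ x → (+ p) ℤ.^ d ∣ eval f x) where

  P : ℤ
  P = + p

  F : Poly
  F = fallingPoly p

  expansion : Σ (ℕ → Poly) λ r → (∀ n → n < d → length (r n) ≤ p) × f ≈ hornerₚ F r d
  expansion = fallingPoly-expansion p d f

  r : ℕ → Poly
  r = proj₁ expansion

  r-short : ∀ n → n < d → length (r n) ≤ p
  r-short = proj₁ (proj₂ expansion)

  f≈ : f ≈ hornerₚ F r d
  f≈ = proj₂ (proj₂ expansion)

  -- Truncated subtraction makes the condition vacuous for n ≥ j.
  Divisible : ℕ → Set
  Divisible j = ∀ n → P ℤ.^ (j ℕ.∸ n) ∣ₚ r n

  divisible-zero : Divisible 0
  divisible-zero zero    = λ i → 1∣ _
  divisible-zero (suc n) = λ i → 1∣ _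

  module Step {j} (j<d : j < d) (divisible-j : Divisible j) where

    quotients : ∀ n → Σ Poly λ g → r n ≈ (P ℤ.^ (j ℕ.∸ n)) · g × length g ≡ length (r n)
    quotients n = ∣ₚ⇒quotient _ (r n) (divisible-j n)

    s : ℕ → Poly
    s n = proj₁ (quotients n)

    r≈ : ∀ n → r n ≈ (P ℤ.^ (j ℕ.∸ n)) · s n
    r≈ n = proj₁ (proj₂ (quotients n))

    s-short : ∀ n → n < d → length (s n) ≤ p
    s-short n n<d = subst (_≤ p) (sym (proj₂ (proj₂ (quotients n)))) (r-short n n<d)

    module Residue {a} (a<p : a < p) where

      c : ℤ
      c = fallingExcept p a (+ a)

      σ′ : ℕ → ℤ
      σ′ n = eval (s n) (+ a)

      module _ (t : ℤ) where
        x : ℤ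
        x = + a + P * t

        ψ : ℤ
        ψ = fallingExcept p a x * t

        x≡a : x ≡ + a [mod P ]
        x≡a = mod-∣ (divides t (cancel (+ a) P t))
          where cancel : ∀ a P t → (a + P * t) - a ≡ t * P
                cancel = solve-∀

        F[x]≡Pψ : eval F x ≡ P * ψ
        F[x]≡Pψ = trans (fallingPoly-factor x a<p) (regroup (+ a) P t (fallingExcept p a x))
          where regroup : ∀ a P t W → ((a + P * t) - a) * W ≡ P * (W * t)
                regroup = solve-∀

        f[x]≡ : eval f x ≡ horner (λ n → eval (r n) x) (P * ψ) d
        f[x]≡ = trans (eval-cong x f≈)
          (trans (eval-hornerₚ F r d x) (cong (λ φ → horner (λ n → eval (r n) x) φ d) F[x]≡Pψ))

        H : ℤ
        H = horner (λ n → eval (s n) x) ψ j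

        Pʲ⁺¹∣PʲH : P ℤ.^ suc j ∣ P ℤ.^ j * H
        Pʲ⁺¹∣PʲH = ∣-resp-mod (mod-sym (horner-scaled P ψ _ _ (ℕ.<⇒≤ j<d) ρ≡))
          (subst (P ℤ.^ suc j ∣_) f[x]≡ (∣.∣-trans (^-∣-^ P j<d) (null x)))
          where ρ≡ : ∀ n → eval (r n) x ≡ P ℤ.^ (j ℕ.∸ n) * eval (s n) x
                ρ≡ n = trans (eval-cong x (r≈ n)) (eval-· _ (s n) x)

        P∣H : P ∣ H
        P∣H = ∣.*-cancelˡ-∣ (P ℤ.^ j) {{Pʲ≢0}}
          (subst (_∣ P ℤ.^ j * H) (ℤ.*-comm P (P ℤ.^ j)) Pʲ⁺¹∣PʲH)
          where Pʲ≢0 : ℤ.NonZero (P ℤ.^ j)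
                Pʲ≢0 = subst ℤ.NonZero (pos-^ p j) (ℕ.m^n≢0 p j {{prime⇒nonZero p-prime}})

        P∣reduced : P ∣ horner σ′ (c * t) j
        P∣reduced = ∣-resp-mod (mod-sym (horner-mod _ σ′ ψ (c * t) j (λ n → eval-mod-point (s n) x≡a)
                                           (mod-* (fallingExcept-mod p a x≡a) (mod-refl {a = t}))))
                               P∣H

      σ′-vanishes : ∀ n → n ≤ j → P ∣ σ′ n
      σ′-vanishes n n≤j =
        prime∣*∤⇒∣ p-prime (σ′ n) (prime∤^ p-prime n (prime∤fallingExcept p-prime ℕ.≤-refl a<p))
        (subst (P ∣_) (coeff-applyUpTo G-coeff (s≤s n≤j)) (P∣G n))
        where
        G-coeff : ℕ → ℤ
        G-coeff n = c ℤ.^ n * σ′ n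
        P∣G : P ∣ₚ applyUpTo G-coeff (suc j)
        P∣G = roots⇒∣ₚ p-prime (suc j) _ (+ 0) (ℕ.≤-trans j<d d≤p)
                (ℕ.≤-reflexive (length-applyUpTo G-coeff (suc j)))
          λ i _ → subst (P ∣_) (sym (trans (eval-applyUpTo G-coeff j (+ 0 + + i)) (sym (horner-*-point σ′ c _ j))))
                    (P∣reduced (+ 0 + + i))

    s-divisible : ∀ n → n ≤ j → P ∣ₚ s n
    s-divisible n n≤j = roots⇒∣ₚ p-prime p (s n) (+ 0) ℕ.≤-refl (s-short n (ℕ.≤-<-trans n≤j j<d))
      λ a a<p → subst (λ z → P ∣ eval (s n) z) (sym (ℤ.+-identityˡ (+ a))) (Residue.σ′-vanishes a<p n n≤j)

    divisible-suc : Divisible (suc j)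
    divisible-suc n with n ℕ.≤? j
    ... | yes n≤j = subst (λ e → P ℤ.^ e ∣ₚ r n) (sym (ℕ.+-∸-assoc 1 n≤j))
          (∣ₚ-resp-≈ (≈-sym (r≈ n)) (subst (_∣ₚ ((P ℤ.^ (j ℕ.∸ n)) · s n)) (ℤ.*-comm (P ℤ.^ (j ℕ.∸ n)) P)
            (∣ₚ-·-scale (P ℤ.^ (j ℕ.∸ n)) (s n) (s-divisible n n≤j))))
    ... | no  n≰j =
          subst (λ e → P ℤ.^ e ∣ₚ r n) (trans (ℕ.m≤n⇒m∸n≡0 (ℕ.<⇒≤ j<n)) (sym (ℕ.m≤n⇒m∸n≡0 j<n)))
          (divisible-j n)
          where j<n : j < n
                j<n = ℕ.≰⇒> n≰j

  divisible : ∀ j → j ≤ d → Divisible j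
  divisible zero    _   = divisible-zero
  divisible (suc j) j<d = Step.divisible-suc j<d (divisible j (ℕ.<⇒≤ j<d))

  quotients : ∀ n → Σ Poly λ g → r n ≈ (+ (p ℕ.^ (d ℕ.∸ n))) · g × length g ≡ length (r n)
  quotients n = ∣ₚ⇒quotient _ (r n) (subst (_∣ₚ r n) (sym (pos-^ p (d ℕ.∸ n))) (divisible d ℕ.≤-refl n))

  q : ℕ → Poly
  q n = proj₁ (quotients n)

  q-short : ∀ n → 1 ≤ n → n < d → DegLt (q n) p
  q-short n _ n<d = subst (_≤ p) (sym (proj₂ (proj₂ (quotients n)))) (r-short n n<d)

  congruence : f ≡ₚ partialSum p d q d [mod + (p ℕ.^ d) ]
  congruence = ≈⊕∣ₚ⇒≡ₚ f (r 0) (partialSum p d q d) f≈r₀⊕partialSum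
    (subst (_∣ₚ r 0) (sym (pos-^ p d)) (divisible d ℕ.≤-refl 0))
    where
    f≈r₀⊕partialSum : f ≈ r 0 ⊕ partialSum p d q d
    f≈r₀⊕partialSum = ≈-trans f≈ (≈-trans (hornerₚ≈powerSum F r d)
      (⊕-congˡ (r 0) (powerSum≈partialSum p d q r d (proj₁ ∘ proj₂ ∘ quotients))))

null⇒expansion : ∀ {p d} → Prime p → d ≤ p → ∀ f → NullPoly (+ (p ℕ.^ d)) f →
  Σ (ℕ → Poly) λ q → (∀ n → 1 ≤ n → n < d → DegLt (q n) p) ×
                     (f ≡ₚ partialSum p d q d [mod + (p ℕ.^ d) ])
null⇒expansion {p} {d} p-prime d≤p f null = q , q-short , congruence
  where open NullExpansion p-prime d≤p f (λ x → subst (_∣ eval f x) (pos-^ p d) (∣.∣ᵤ⇒∣ (null x)))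

prime^∣partialSum : ∀ {p} → Prime p → ∀ d q x {k} → k ≤ d → (+ p) ℤ.^ d ∣ eval (partialSum p d q k) x
prime^∣partialSum     p-prime d q x {zero}  _   = ∣-zero _
prime^∣partialSum {p} p-prime d q x {suc k} k<d =
  subst ((+ p) ℤ.^ d ∣_) (sym (eval-⊕ (partialSum p d q k) ((+ (p ℕ.^ e)) · ((F ^ₚ suc k) ⊗ q (suc k))) x))
    (∣.∣m∣n⇒∣m+n (prime^∣partialSum p-prime d q x (ℕ.<⇒≤ k<d))
                 (subst₂ _∣_ exponents (sym term) divisibility))
  where
  F : Poly
  F = fallingPoly p
  e : ℕ
  e = d ℕ.∸ suc k
  term : eval ((+ (p ℕ.^ e)) · ((F ^ₚ suc k) ⊗ q (suc k))) x
       ≡ (+ p) ℤ.^ e * (eval F x ℤ.^ suc k * eval (q (suc k)) x)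
  term = trans (eval-· (+ (p ℕ.^ e)) ((F ^ₚ suc k) ⊗ q (suc k)) x) (cong₂ _*_ (pos-^ p e)
           (trans (eval-⊗ (F ^ₚ suc k) (q (suc k)) x) (cong (_* eval (q (suc k)) x) (eval-^ₚ F (suc k) x))))
  exponents : (+ p) ℤ.^ e * (+ p) ℤ.^ suc k ≡ (+ p) ℤ.^ d
  exponents = trans (sym (ℤ.^-distribˡ-+-* (+ p) e (suc k))) (cong ((+ p) ℤ.^_) (ℕ.m∸n+n≡m k<d))
  divisibility : (+ p) ℤ.^ e * (+ p) ℤ.^ suc k ∣ (+ p) ℤ.^ e * (eval F x ℤ.^ suc k * eval (q (suc k)) x)
  divisibility = ∣.*-monoʳ-∣ ((+ p) ℤ.^ e) (∣.∣m⇒∣m*n _ (∣-^ (suc k) (prime∣fallingPoly p-prime x)))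

expansion⇒null : ∀ {p d} → Prime p → ∀ f q →
  f ≡ₚ partialSum p d q d [mod + (p ℕ.^ d) ] → NullPoly (+ (p ℕ.^ d)) f
expansion⇒null {p} {d} p-prime f q f≡ₚ x = ∣.∣⇒∣ᵤ (∣-resp-mod
  (eval-mod-coeff f (partialSum p d q d) x (λ i → mod-∣ (∣.∣ᵤ⇒∣ (f≡ₚ i))))
  (subst (_∣ eval (partialSum p d q d) x) (sym (pos-^ p d)) (prime^∣partialSum p-prime d q x ℕ.≤-refl)))

mainTheorem14 : (p d : ℕ) → Prime p → 2 ≤ d → d ≤ p → (f : Poly) →
    NullPoly (+ (p ^ d)) f ⇔
      Σ (ℕ → Poly) (λ q →
        (∀ (n : ℕ) → 1 ≤ n → n < d → DegLt (q n) p) ×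
        (f ≡ₚ partialSum p d q d [mod + (p ^ d) ]))
mainTheorem14 p d p-prime _ d≤p f =
  mk⇔ (null⇒expansion p-prime d≤p f) (λ (q , _ , f≡ₚ) → expansion⇒null {d = d} p-prime f q f≡ₚ)
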